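{- Let $\Sigma$ be a finite alphabet with $J$ predicate symbols and $E$ constant and function symbols, let $m\ge 1$, $k\ge 1$ and $D_{\max}\in\mathbb{N}$. The number $L_\Sigma(m,k,D_{\max})$ of different $\delta$-configurations (for $D_{\max}$) of configurations over $\Sigma$ having exactly $m$ facts, each of size at most $k$, satisfies $L_\Sigma(m,k,D_{\max}) \le (D_{\max}+2)^{m-1} J^m (E+2mk)^{mk}$.
   Context: A timestamped fact is $F@t$ where $F$ is a ground fact (atomic formula) over $\Sigma$ and $t\in\mathbb{N}$; a configuration is a finite multiset of timestamped facts containing exactly one fact $Time@t$ of the special nullary predicate $Time$ (counted among the $J$ predicate symbols). The size $|F@t|$ of a timestamped fact is the total number of alphabet symbols occurring in $F$ (e.g. $|P(s(z),f(a,X),a)@12|=7$). For a given $D_{\max}$, the truncated time difference of two timestamped facts $P@t_1$ and $Q@t_2$ with $t_1\le t_2$ is $\delta_{P,Q}=t_2-t_1$ if $t_2-t_1\le D_{\max}$ and $\delta_{P,Q}=\infty$ otherwise. If a configuration is written as $Q_1@t_1,\ldots,Q_n@t_n$ with $t_1\le t_2\le\cdots\le t_n$, its $\delta$-configuration is the sequence $[Q_1,\delta_{Q_1,Q_2},Q_2,\ldots,Q_{n-1},\delta_{Q_{n-1},Q_n},Q_n]$. -}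

module Defs where

open import Data.Nat using (ℕ; zero; suc; _+_; _∸_; _≤_; _≤?_)
open import Data.Fin using (Fin)
open import Data.Fin.Properties using () renaming (_≟_ to _≟ᶠ_)
open import Data.Vec using (Vec; []; _∷_)
open import Data.List using (List; []; _∷_; length; filter)
open import Data.List.Relation.Unary.All using (All)
open import Data.List.Relation.Unary.Linked using (Linked)
open import Data.List.Relation.Binary.Permutation.Propositional using (_↭_)
open import Data.Maybe using (Maybe; just; nothing)
open import Data.Product using (_×_; _,_; proj₁; proj₂; Σ; ∃)
open import Relation.Binary.PropositionalEquality using (_≡_)
open import Relation.Nullary using (yes; no)

record Signature : Set where
  field
    J        : ℕ
    parity   : Fin J → ℕ
    Time     : Fin J
    Time-nullary : parity Time ≡ 0
    E        : ℕ
    farity   : Fin E → ℕ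
open Signature public

module _ (S : Signature) where

  data Term : Set where
    app : (f : Fin (E S)) → Vec Term (farity S f) → Term

  record Fact : Set where
    constructor fact
    field
      pred : Fin (J S)
      args : Vec Term (parity S pred)
  open Fact public

  mutual
    termSize : Term → ℕ
    termSize (app f ts) = suc (termsSize ts)

    termsSize : ∀ {n} → Vec Term n → ℕ
    termsSize [] = 0
    termsSize (t ∷ ts) = termSize t + termsSize ts

  factSize : Fact → ℕ
  factSize (fact p as) = suc (termsSize as)

  TFact : Set
  TFact = Fact × ℕ

  -- a configuration: a finite multiset of timestamped facts, represented as a
  -- list (order irrelevant: see IsDeltaConfOf, which quantifies over permutations)
  Config : Set
  Config = List TFact

  isTime : TFact → Set
  isTime tf = pred (proj₁ tf) ≡ Time S

  timeCount : Config → ℕ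
  timeCount c = length (filter (λ tf → pred (proj₁ tf) ≟ᶠ Time S) c)

  ValidConfig : ℕ → ℕ → Config → Set
  ValidConfig m k c = timeCount c ≡ 1 × length c ≡ m × All (λ tf → factSize (proj₁ tf) ≤ k) c

  -- truncated time differences: just d for d ≤ Dmax, nothing for ∞
  Delta : Set
  Delta = Maybe ℕ

  truncDiff : ℕ → ℕ → ℕ → Delta
  truncDiff Dmax t₁ t₂ with t₂ ∸ t₁ ≤? Dmax
  ... | yes _ = just (t₂ ∸ t₁)
  ... | no  _ = nothing

  -- a δ-configuration [Q₁, δ₁₂, Q₂, …, δ, Qₙ] is represented as
  -- (Q₁ , [(δ₁₂ , Q₂), …]) ; only nonempty ones (m ≥ 1) arise here
  DeltaConf : Set
  DeltaConf = Fact × List (Delta × Fact)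

  deltaTail : ℕ → TFact → List TFact → List (Delta × Fact)
  deltaTail Dmax _ [] = []
  deltaTail Dmax (F , t) ((G , u) ∷ rest) = (truncDiff Dmax t u , G) ∷ deltaTail Dmax (G , u) rest

  deltaConfOf : ℕ → TFact → List TFact → DeltaConf
  deltaConfOf Dmax (F , t) rest = F , deltaTail Dmax (F , t) rest

  IsDeltaConfOf : ℕ → Config → DeltaConf → Set
  IsDeltaConfOf Dmax c d =
    Σ TFact λ q → Σ (List TFact) λ qs →
      ((q ∷ qs) ↭ c) × Linked (λ a b → proj₂ a ≤ proj₂ b) (q ∷ qs) × deltaConfOf Dmax q qs ≡ d

  IsLDeltaConf : ℕ → ℕ → ℕ → DeltaConf → Set
  IsLDeltaConf m k Dmax d = ∃ λ c → ValidConfig m k c × IsDeltaConfOf Dmax c d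

-- A δ-configuration [Q₁, δ₁₂, Q₂, …, Qₘ] consists of a fact followed by m − 1 pairs
-- (δ, fact), where δ takes one of the D + 2 values 0, …, D, ∞. A ground fact of size at
-- most k is its predicate symbol followed by its arguments written in Polish notation, a
-- word of at most k − 1 function symbols; Polish notation is uniquely readable, and padding
-- the word with blanks to length exactly k − 1 makes the fact one of J·(E+1)^(k−1) codes.
-- So there are at most J(E+1)^(k−1) · ((D+2)·J(E+1)^(k−1))^(m−1) δ-configurations, which
-- is below the stated bound since E + 1 ≤ E + 2mk.
module Submission where

open import Defs
open import Data.Empty using (⊥-elim)
open import Data.Fin using (Fin)
open import Data.List using (List; []; _∷_; [_]; _++_; length; map; replicate; catMaybes; upTo; allFin; cartesianProduct; cartesianProductWith)
open import Data.List.Membership.Propositional using (_∈_)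
open import Data.List.Membership.Propositional.Properties using (∈-map⁺; ∈-map⁻; ∈-++⁺ˡ; ∈-++⁺ʳ; ∈-++⁻; ∈-∃++; ∈-upTo⁺; ∈-allFin; ∈-cartesianProduct⁺; ∈-cartesianProductWith⁺)
open import Data.List.Properties using (length-map; length-++; length-++-sucʳ; length-upTo; length-tabulate; length-replicate; ++-assoc; ++-identityʳ; ∷-injective; map-injective)
open import Data.List.Relation.Binary.Permutation.Propositional using (↭-sym)
open import Data.List.Relation.Binary.Permutation.Propositional.Properties using (All-resp-↭; ↭-length)
open import Data.List.Relation.Binary.Subset.Propositional using (_⊆_)
open import Data.List.Relation.Unary.All as All using (All; []; _∷_)
open import Data.List.Relation.Unary.AllPairs using (_∷_)
open import Data.List.Relation.Unary.Any using (here; there)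
open import Data.List.Relation.Unary.Unique.Propositional using (Unique)
import Data.List.Relation.Unary.Unique.Propositional.Properties as Unique
open import Data.Maybe using (Maybe; just; nothing)
open import Data.Nat using (ℕ; zero; suc; _+_; _*_; _∸_; _^_; _≤_; _≤?_; z≤n; s≤s; >-nonZero)
open import Data.Nat.Properties
open import Algebra.Properties.CommutativeSemigroup *-commutativeSemigroup using (interchange; x∙yz≈y∙xz)
open import Data.Product using (_×_; _,_; proj₁; map₂)
open import Data.Product.Properties using (,-injective)
open import Data.Sum using (inj₁; inj₂)
open import Data.Vec using (Vec; []; _∷_)
open import Function.Definitions using (Injective)
open import Relation.Binary.PropositionalEquality using (_≡_; refl; sym; trans; cong; cong₂; module ≡-Reasoning)
open import Relation.Nullary using (yes; no)

private
  variable
    A B C : Set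

Unique-⊆⇒length≤ : {xs ys : List A} → Unique xs → xs ⊆ ys → length xs ≤ length ys
Unique-⊆⇒length≤ {xs = []} _ _ = z≤n
Unique-⊆⇒length≤ {xs = x ∷ xs} (x∉xs ∷ !xs) xs⊆ys with ∈-∃++ (xs⊆ys (here refl))
... | us , vs , refl = begin
    suc (length xs)         ≤⟨ s≤s (Unique-⊆⇒length≤ !xs xs⊆us++vs) ⟩
    suc (length (us ++ vs)) ≡⟨ length-++-sucʳ us x vs ⟨
    length (us ++ x ∷ vs)   ∎
  where
  open ≤-Reasoning
  xs⊆us++vs : xs ⊆ us ++ vs
  xs⊆us++vs y∈xs with ∈-++⁻ us (xs⊆ys (there y∈xs))
  ... | inj₁ y∈us         = ∈-++⁺ˡ y∈us
  ... | inj₂ (here refl)  = ⊥-elim (All.lookup x∉xs y∈xs refl)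
  ... | inj₂ (there y∈vs) = ∈-++⁺ʳ us y∈vs

length≤-by-injection : (f : A → B) → Injective _≡_ _≡_ f → {xs : List A} {ys : List B} →
  Unique xs → (∀ {x} → x ∈ xs → f x ∈ ys) → length xs ≤ length ys
length≤-by-injection f f-injective {xs} {ys} !xs f∈ys = begin
  length xs         ≡⟨ length-map f xs ⟨
  length (map f xs) ≤⟨ Unique-⊆⇒length≤ (Unique.map⁺ f-injective !xs) f[xs]⊆ys ⟩
  length ys         ∎
  where
  open ≤-Reasoning
  f[xs]⊆ys : map f xs ⊆ ys
  f[xs]⊆ys fx∈f[xs] with _ , x∈xs , refl ← ∈-map⁻ f fx∈f[xs] = f∈ys x∈xs

length-cartesianProductWith : (f : A → B → C) (xs : List A) (ys : List B) →
  length (cartesianProductWith f xs ys) ≡ length xs * length ys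
length-cartesianProductWith f []       ys = refl
length-cartesianProductWith f (x ∷ xs) ys = begin
  length (map (f x) ys ++ cartesianProductWith f xs ys)
    ≡⟨ length-++ (map (f x) ys) ⟩
  length (map (f x) ys) + length (cartesianProductWith f xs ys)
    ≡⟨ cong₂ _+_ (length-map (f x) ys) (length-cartesianProductWith f xs ys) ⟩
  length ys + length xs * length ys
    ∎
  where open ≡-Reasoning

length-cartesianProduct : (xs : List A) (ys : List B) →
  length (cartesianProduct xs ys) ≡ length xs * length ys
length-cartesianProduct = length-cartesianProductWith _,_

wordsOfLength : ℕ → List A → List (List A)
wordsOfLength zero    ys = [ [] ]
wordsOfLength (suc n) ys = cartesianProductWith _∷_ ys (wordsOfLength n ys)

length-wordsOfLength : ∀ n (ys : List A) → length (wordsOfLength n ys) ≡ length ys ^ n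
length-wordsOfLength zero    ys = refl
length-wordsOfLength (suc n) ys =
  trans (length-cartesianProductWith _∷_ ys (wordsOfLength n ys)) (cong (length ys *_) (length-wordsOfLength n ys))

∈-wordsOfLength : ∀ {n} {ys w : List A} → length w ≡ n → All (_∈ ys) w → w ∈ wordsOfLength n ys
∈-wordsOfLength {w = []}    refl []            = here refl
∈-wordsOfLength {w = _ ∷ _} refl (x∈ys ∷ w⊆ys) = ∈-cartesianProductWith⁺ _∷_ x∈ys (∈-wordsOfLength refl w⊆ys)

^-distribʳ-* : ∀ m n o → (m * n) ^ o ≡ m ^ o * n ^ o
^-distribʳ-* m n zero    = refl
^-distribʳ-* m n (suc o) = trans (cong (m * n *_) (^-distribʳ-* m n o))
                                 (interchange m n (m ^ o) (n ^ o))

module _ (S : Signature) where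

  Symbol : Set
  Symbol = Fin (E S)

  mutual
    polish : Term S → List Symbol
    polish (app f ts) = f ∷ polishAll ts

    polishAll : ∀ {n} → Vec (Term S) n → List Symbol
    polishAll []       = []
    polishAll (t ∷ ts) = polish t ++ polishAll ts

  mutual
    length-polish : (t : Term S) → length (polish t) ≡ termSize S t
    length-polish (app f ts) = cong suc (length-polishAll ts)

    length-polishAll : ∀ {n} (ts : Vec (Term S) n) → length (polishAll ts) ≡ termsSize S ts
    length-polishAll []       = refl
    length-polishAll (t ∷ ts) = trans (length-++ (polish t)) (cong₂ _+_ (length-polish t) (length-polishAll ts))

  mutual
    polish-++-injective : ∀ t t' {r r' : List Symbol} →
      polish t ++ r ≡ polish t' ++ r' → t ≡ t' × r ≡ r'
    polish-++-injective (app f ts) (app f' ts') eq with ∷-injective eq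
    ... | refl , eq' with polishAll-++-injective ts ts' eq'
    ... | refl , refl = refl , refl

    polishAll-++-injective : ∀ {n} (ts ts' : Vec (Term S) n) {r r' : List Symbol} →
      polishAll ts ++ r ≡ polishAll ts' ++ r' → ts ≡ ts' × r ≡ r'
    polishAll-++-injective []       []         eq = refl , eq
    polishAll-++-injective (t ∷ ts) (t' ∷ ts') {r} {r'} eq
      with polish-++-injective t t' (trans (sym (++-assoc (polish t) _ r)) (trans eq (++-assoc (polish t') _ r')))
    ... | refl , eq' with polishAll-++-injective ts ts' eq'
    ... | refl , refl = refl , refl

  polishAll-injective : ∀ {n} → Injective _≡_ _≡_ (polishAll {n})
  polishAll-injective {x = ts} {ts'} eq =
    proj₁ (polishAll-++-injective ts ts' (trans (++-identityʳ (polishAll ts)) (trans eq (sym (++-identityʳ (polishAll ts'))))))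

  -- `nothing` is the blank
  pad : ℕ → List Symbol → List (Maybe Symbol)
  pad n w = map just w ++ replicate (n ∸ length w) nothing

  length-pad : ∀ n (w : List Symbol) → length w ≤ n → length (pad n w) ≡ n
  length-pad n w |w|≤n = begin
    length (map just w ++ replicate (n ∸ length w) nothing)
      ≡⟨ length-++ (map just w) ⟩
    length (map just w) + length (replicate (n ∸ length w) nothing)
      ≡⟨ cong₂ _+_ (length-map just w) (length-replicate (n ∸ length w)) ⟩
    length w + (n ∸ length w)
      ≡⟨ m+[n∸m]≡n |w|≤n ⟩
    n ∎
    where open ≡-Reasoning

  catMaybes-pad : ∀ n (w : List Symbol) → catMaybes (pad n w) ≡ w
  catMaybes-pad n w = go w (n ∸ length w)
    where
    go : ∀ (w : List Symbol) a → catMaybes (map just w ++ replicate a nothing) ≡ w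
    go []      zero    = refl
    go []      (suc a) = go [] a
    go (x ∷ w) a       = cong (x ∷_) (go w a)

  pad-injective : ∀ n → Injective _≡_ _≡_ (pad n)
  pad-injective n {w} {w'} eq = begin
    w                     ≡⟨ catMaybes-pad n w ⟨
    catMaybes (pad n w)   ≡⟨ cong catMaybes eq ⟩
    catMaybes (pad n w')  ≡⟨ catMaybes-pad n w' ⟩
    w'                    ∎
    where open ≡-Reasoning

  FactCode : Set
  FactCode = Fin (J S) × List (Maybe Symbol)

  encodeFact : ℕ → Fact S → FactCode
  encodeFact n (fact p as) = p , pad n (polishAll as)

  encodeFact-injective : ∀ n → Injective _≡_ _≡_ (encodeFact n)
  encodeFact-injective n {fact p as} {fact p' as'} eq with ,-injective eq
  ... | refl , eq' with polishAll-injective {x = as} {as'} (pad-injective n eq')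
  ... | refl = refl

  factCodes : ℕ → List FactCode
  factCodes n = cartesianProduct (allFin (J S)) (wordsOfLength n (nothing ∷ map just (allFin (E S))))

  length-factCodes : ∀ n → length (factCodes n) ≡ J S * suc (E S) ^ n
  length-factCodes n = trans (length-cartesianProduct (allFin (J S)) _)
    (cong₂ _*_ (length-tabulate {n = J S} (λ i → i))
      (trans (length-wordsOfLength n _) (cong (λ e → suc e ^ n)
        (trans (length-map just (allFin (E S))) (length-tabulate {n = E S} (λ i → i))))))

  encodeFact∈factCodes : ∀ k (F : Fact S) → factSize S F ≤ k → encodeFact (k ∸ 1) F ∈ factCodes (k ∸ 1)
  encodeFact∈factCodes (suc k) (fact p as) (s≤s |as|≤k) =
    ∈-cartesianProduct⁺ (∈-allFin p)
      (∈-wordsOfLength (length-pad k (polishAll as) (≤-trans (≤-reflexive (length-polishAll as)) |as|≤k))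
               (All.tabulate symbol∈))
    where
    symbol∈ : ∀ {x} → x ∈ pad k (polishAll as) → x ∈ nothing ∷ map just (allFin (E S))
    symbol∈ {nothing} _ = here refl
    symbol∈ {just f}  _ = there (∈-map⁺ just (∈-allFin f))

  deltas : ℕ → List (Delta S)
  deltas D = nothing ∷ map just (upTo (suc D))

  length-deltas : ∀ D → length (deltas D) ≡ suc (suc D)
  length-deltas D = cong suc (trans (length-map just (upTo (suc D))) (length-upTo (suc D)))

  truncDiff∈deltas : ∀ D t u → truncDiff S D t u ∈ deltas D
  truncDiff∈deltas D t u with u ∸ t ≤? D
  ... | yes d≤D = there (∈-map⁺ just (∈-upTo⁺ (s≤s d≤D)))
  ... | no  _   = here refl

  length-deltaTail : ∀ D q (qs : List (TFact S)) → length (deltaTail S D q qs) ≡ length qs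
  length-deltaTail D q       []       = refl
  length-deltaTail D (F , t) (q ∷ qs) = cong suc (length-deltaTail D q qs)

  DeltaConfCode : Set
  DeltaConfCode = FactCode × List (Delta S × FactCode)

  encodeDeltaConf : ℕ → DeltaConf S → DeltaConfCode
  encodeDeltaConf n (F , rest) = encodeFact n F , map (map₂ (encodeFact n)) rest

  encodeDeltaConf-injective : ∀ n → Injective _≡_ _≡_ (encodeDeltaConf n)
  encodeDeltaConf-injective n eq with ,-injective eq
  ... | eq₁ , eq₂ = cong₂ _,_ (encodeFact-injective n eq₁) (map-injective step-injective eq₂)
    where
    step-injective : Injective _≡_ _≡_ (map₂ {A = Delta S} (encodeFact n))
    step-injective eq' with ,-injective eq'
    ... | refl , eq'' = cong (_ ,_) (encodeFact-injective n eq'')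

  deltaConfCodes : ℕ → ℕ → ℕ → List DeltaConfCode
  deltaConfCodes m n D = cartesianProduct (factCodes n) (wordsOfLength (m ∸ 1) (cartesianProduct (deltas D) (factCodes n)))

  length-deltaConfCodes : ∀ m n D →
    length (deltaConfCodes m n D) ≡ J S * suc (E S) ^ n * (suc (suc D) * (J S * suc (E S) ^ n)) ^ (m ∸ 1)
  length-deltaConfCodes m n D = trans (length-cartesianProduct (factCodes n) _)
    (cong₂ _*_ (length-factCodes n)
      (trans (length-wordsOfLength (m ∸ 1) _) (cong (_^ (m ∸ 1))
        (trans (length-cartesianProduct (deltas D) (factCodes n)) (cong₂ _*_ (length-deltas D) (length-factCodes n))))))

  encodeDeltaConf∈deltaConfCodes : ∀ m k D {d} → IsLDeltaConf S m k D d →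
    encodeDeltaConf (k ∸ 1) d ∈ deltaConfCodes m (k ∸ 1) D
  encodeDeltaConf∈deltaConfCodes m k D (c , (_ , |c|≡m , small) , q , qs , q∷qs↭c , _ , refl) =
    ∈-cartesianProduct⁺ (encodeFact∈factCodes k (proj₁ q) (All.head small′))
      (∈-wordsOfLength |tail|≡m∸1 (tail∈ q qs (All.tail small′)))
    where
    small′ : All (λ tf → factSize S (proj₁ tf) ≤ k) (q ∷ qs)
    small′ = All-resp-↭ (↭-sym q∷qs↭c) small

    |tail|≡m∸1 : length (map (map₂ (encodeFact (k ∸ 1))) (deltaTail S D q qs)) ≡ m ∸ 1
    |tail|≡m∸1 = trans (length-map _ (deltaTail S D q qs))
      (trans (length-deltaTail D q qs) (cong (_∸ 1) (trans (↭-length q∷qs↭c) |c|≡m)))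

    tail∈ : ∀ q qs → All (λ tf → factSize S (proj₁ tf) ≤ k) qs →
      All (_∈ cartesianProduct (deltas D) (factCodes (k ∸ 1))) (map (map₂ (encodeFact (k ∸ 1))) (deltaTail S D q qs))
    tail∈ q       []             []               = []
    tail∈ (F , t) ((G , u) ∷ qs) (|G|≤k ∷ small″) =
      ∈-cartesianProduct⁺ (truncDiff∈deltas D t u) (encodeFact∈factCodes k G |G|≤k) ∷ tail∈ (G , u) qs small″

count≤bound : ∀ d j e m′ k′ →
  j * suc e ^ k′ * (d * (j * suc e ^ k′)) ^ m′ ≤ d ^ m′ * j ^ suc m′ * (e + 2 * suc m′ * suc k′) ^ (suc m′ * suc k′)
count≤bound d j e m′ k′ = begin
  c * (d * c) ^ m′          ≤⟨ *-mono-≤ c≤F (^-monoˡ-≤ m′ (*-monoʳ-≤ d c≤F)) ⟩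
  F * (d * F) ^ m′          ≡⟨ cong (F *_) (^-distribʳ-* d F m′) ⟩
  F * (d ^ m′ * F ^ m′)     ≡⟨ x∙yz≈y∙xz F (d ^ m′) (F ^ m′) ⟩
  d ^ m′ * F ^ m            ≡⟨ cong (d ^ m′ *_) (^-distribʳ-* j (a ^ k) m) ⟩
  d ^ m′ * (j ^ m * (a ^ k) ^ m) ≡⟨ *-assoc (d ^ m′) (j ^ m) _ ⟨
  d ^ m′ * j ^ m * (a ^ k) ^ m   ≡⟨ cong (d ^ m′ * j ^ m *_) (trans (^-*-assoc a k m) (cong (a ^_) (*-comm k m))) ⟩
  d ^ m′ * j ^ m * a ^ (m * k)   ∎
  where
  open ≤-Reasoning
  m = suc m′
  k = suc k′
  a = e + 2 * m * k
  c = j * suc e ^ k′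
  F = j * a ^ k
  1+e≤a : suc e ≤ a
  1+e≤a = ≤-trans (≤-reflexive (+-comm 1 e)) (+-monoʳ-≤ e (s≤s z≤n))
  c≤F : c ≤ F
  c≤F = *-monoʳ-≤ j (≤-trans (^-monoˡ-≤ k′ 1+e≤a) (^-monoʳ-≤ a {{>-nonZero (≤-trans (s≤s z≤n) 1+e≤a)}} (n≤1+n k′)))

lemma1 : (S : Signature) (m k Dmax : ℕ) → 1 ≤ m → 1 ≤ k →
    (ds : List (DeltaConf S)) → Unique ds → All (IsLDeltaConf S m k Dmax) ds →
    length ds ≤ (Dmax + 2) ^ (m ∸ 1) * J S ^ m * (E S + 2 * m * k) ^ (m * k)
lemma1 S m@(suc m′) k@(suc k′) D _ _ ds !ds valid = begin
  length ds
    ≤⟨ length≤-by-injection (encodeDeltaConf S k′) (encodeDeltaConf-injective S k′) !ds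
         (λ d∈ds → encodeDeltaConf∈deltaConfCodes S m k D (All.lookup valid d∈ds)) ⟩
  length (deltaConfCodes S m k′ D)
    ≡⟨ length-deltaConfCodes S m k′ D ⟩
  J S * suc (E S) ^ k′ * (suc (suc D) * (J S * suc (E S) ^ k′)) ^ m′
    ≤⟨ count≤bound (suc (suc D)) (J S) (E S) m′ k′ ⟩
  suc (suc D) ^ m′ * J S ^ m * (E S + 2 * m * k) ^ (m * k)
    ≡⟨ cong (λ d → d ^ m′ * J S ^ m * (E S + 2 * m * k) ^ (m * k)) (+-comm 2 D) ⟩
  (D + 2) ^ (m ∸ 1) * J S ^ m * (E S + 2 * m * k) ^ (m * k)
    ∎
  where open ≤-Reasoning
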